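{- Let $q$ be a prime power and $n$ a positive even integer. Let $\Omega_{q,n}$ be the set of all distinct double Toeplitz $[n,n/2]$ codes over $\mathbb{F}_q$, and for $u,v\in\mathbb{F}_q^{n/2}$ let $\Omega_{q,n}^{(u,v)}$ be the set of those codes in $\Omega_{q,n}$ that contain the vector $(u,v)\in\mathbb{F}_q^n$. Then \[ |\Omega_{q,n}^{(u,v)}|= \begin{cases} q^{n-1} & \text{if } \mathrm{wt}(u)=0 \text{ and } \mathrm{wt}(v)=0,\\ 0 & \text{if } \mathrm{wt}(u)=0 \text{ and } \mathrm{wt}(v)\ne 0,\\ q^{n/2-1} & \text{if } \mathrm{wt}(u)\ne 0. \end{cases} \]
   Context: For $m\ge1$, $t\in\mathbb{F}_q$, $a=(a_1,\dots,a_{m-1})$, $b=(b_1,\dots,b_{m-1})\in\mathbb{F}_q^{m-1}$, the Toeplitz matrix $T(t,a,b)$ is the $m\times m$ matrix whose $(i,j)$ entry is $t$ if $i=j$, $a_{j-i}$ if $j>i$, and $b_{i-j}$ if $i>j$. The double Toeplitz code $\mathcal{T}(t,a,b)$ is the linear $[2m,m]$ code over $\mathbb{F}_q$ with generator matrix $(I_m \mid T(t,a,b))$. A double Toeplitz $[n,n/2]$ code is such a code with $m=n/2$; "distinct" means distinct as subsets of $\mathbb{F}_q^n$. $\mathrm{wt}(x)$ denotes the Hamming weight (number of nonzero components) of $x$. -}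

module Defs where

open import Level using (0ℓ)
open import Algebra.Bundles using (CommutativeRing)
open import Data.Nat using (ℕ; zero; suc; _∸_)
open import Data.Nat.Properties using (<-cmp)
open import Data.Fin using (Fin; toℕ)
import Data.Fin as Fin
open import Data.Vec using (Vec; []; _∷_)
open import Data.List using (List; length)
open import Data.List.Relation.Unary.All using (All)
open import Data.List.Relation.Unary.Any using (Any)
open import Data.List.Relation.Unary.AllPairs using (AllPairs)
open import Data.Product using (Σ; ∃; _×_; _,_)
open import Relation.Binary using (Decidable; Tri; tri<; tri≈; tri>)
open import Relation.Nullary using (¬_; yes; no)
open import Relation.Binary.PropositionalEquality using (_≡_)

-- A finite field with q = size elements (q is then automatically a prime power).
-- Equality on the carrier is the ring's setoid equality _≈_.
record FiniteField : Set₁ where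
  field
    commRing : CommutativeRing 0ℓ 0ℓ
  open CommutativeRing commRing public
  field
    _≟_      : Decidable _≈_
    0≉1      : ¬ (0# ≈ 1#)
    inverse  : ∀ x → ¬ (x ≈ 0#) → ∃ λ y → (x * y) ≈ 1#
    size     : ℕ
    enum     : Fin size → Carrier
    enum-surj : ∀ x → ∃ λ i → enum i ≈ x
    enum-inj  : ∀ i j → enum i ≈ enum j → i ≡ j

module _ (F : FiniteField) where
  open FiniteField F

  ∑ : ∀ {m} → (Fin m → Carrier) → Carrier
  ∑ {zero}  f = 0#
  ∑ {suc m} f = f Fin.zero + ∑ (λ i → f (Fin.suc i))

  wt : ∀ {m} → (Fin m → Carrier) → ℕ
  wt {zero}  u = 0
  wt {suc m} u with u Fin.zero ≟ 0#
  ... | yes _ = wt (λ i → u (Fin.suc i))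
  ... | no  _ = suc (wt (λ i → u (Fin.suc i)))

  -- a_d for d = 1, ..., k is stored at position d ∸ 1 of a vector of length k
  -- (the default 0# is never used for in-range indices)
  at : ∀ {k} → Vec Carrier k → ℕ → Carrier
  at []       _       = 0#
  at (x ∷ xs) zero    = x
  at (x ∷ xs) (suc d) = at xs d

  Toeplitz : ∀ {m} → Carrier → Vec Carrier (m ∸ 1) → Vec Carrier (m ∸ 1)
           → Fin m → Fin m → Carrier
  Toeplitz t a b i j with <-cmp (toℕ i) (toℕ j)
  ... | tri< _ _ _ = at a (toℕ j ∸ toℕ i ∸ 1)
  ... | tri≈ _ _ _ = t
  ... | tri> _ _ _ = at b (toℕ i ∸ toℕ j ∸ 1)

  Params : ℕ → Set
  Params m = Carrier × Vec Carrier (m ∸ 1) × Vec Carrier (m ∸ 1)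

  Word : ℕ → Set
  Word m = (Fin m → Carrier) × (Fin m → Carrier)

  -- (u , v) ∈ 𝒯(t,a,b), the code generated by (I_m | T(t,a,b)):
  -- (u , v) = w (I | T) for some message w
  _∈𝒯_ : ∀ {m} → Word m → Params m → Set
  _∈𝒯_ {m} (u , v) (t , a , b) =
    ∃ λ (w : Fin m → Carrier) →
      (∀ i → u i ≈ w i) × (∀ j → v j ≈ ∑ (λ i → w i * Toeplitz {m} t a b i j))

  SameCode : ∀ {m} → Params m → Params m → Set
  SameCode {m} p p' = ∀ (x : Word m) → ((_∈𝒯_ {m} x p → _∈𝒯_ {m} x p') × (_∈𝒯_ {m} x p' → _∈𝒯_ {m} x p))

  -- The set of distinct double Toeplitz codes of length 2m containing x has
  -- exactly N elements: L lists representatives, one per distinct code.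
  NumCodesContaining : (m : ℕ) → Word m → ℕ → Set
  NumCodesContaining m x N =
    Σ (List (Params m)) λ L →
      (length L ≡ N)
      × All (λ p → _∈𝒯_ {m} x p) L
      × AllPairs (λ p p' → ¬ SameCode {m} p p') L
      × (∀ (p : Params m) → _∈𝒯_ {m} x p → Any (SameCode {m} p) L)

{-# OPTIONS --safe #-}
module Submission where

-- A double Toeplitz code determines its systematic generator (I | T), and T is determined by its
-- 2m − 1 diagonal values c, with T i j = c (m − 1 − j + i); so codes correspond to vectors
-- c ∈ F_q^(2m−1). The word (u , v) lies in the code iff v = u T, i.e. iff c solves the Hankel
-- system Σᵢ uᵢ c (j + i) = v (m − 1 − j), j < m. For u = 0 every c is a solution if v = 0 and
-- none is otherwise. For u ≠ 0 peel off c₀: if u₀ ≠ 0 the first equation determines c₀ from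
-- the remaining unknowns, and if u₀ = 0 then c₀ occurs in no equation and is free while u
-- shrinks to (u₁, …). Either way the system has exactly q^(m−1) solutions.

open import Level using (0ℓ)
open import Algebra.Bundles using (CommutativeRing)
open import Data.Fin using (Fin; zero; suc; toℕ; fromℕ<; opposite)
open import Data.Fin.Properties using (toℕ≤pred[n]; toℕ-fromℕ<; opposite-prop; opposite-involutive)
open import Data.List as List using (List; []; _∷_; _++_; length; cartesianProduct)
open import Data.List.Properties using (length-map; length-++; length-tabulate)
open import Data.List.Relation.Unary.All as All using (All; []; _∷_)
import Data.List.Relation.Unary.All.Properties as All
open import Data.List.Relation.Unary.AllPairs using ([]; _∷_)
import Data.List.Relation.Unary.AllPairs.Properties as AllPairs
open import Data.List.Relation.Unary.Any using (here)
import Data.List.Relation.Unary.Any.Properties as Any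
import Data.List.Membership.Setoid as Membership
open import Data.List.Membership.Setoid.Properties using (∈-map⁺; ∈-resp-≈; ∈-cartesianProduct⁺)
open import Data.List.Relation.Unary.Unique.Setoid using (Unique)
import Data.List.Relation.Unary.Unique.Setoid.Properties as Unique
open import Data.Nat as ℕ using (ℕ; zero; suc; _<_; _≤_; _∸_; _^_; _/_; s≤s; s≤s⁻¹; z≤n; z<s)
open import Data.Nat.Divisibility using (_∣_; divides)
open import Data.Nat.DivMod using (m*n/n≡m)
import Data.Nat.Properties as ℕₚ
open import Data.Nat.Properties
  using ( <-cmp; _≤?_; ≰⇒≥; +-suc; +-comm; +-mono-≤; +-monoʳ-<; ∸-monoʳ-<; ∸-monoˡ-<; ∸-monoˡ-≤
        ; ∸-+-assoc; m∸n≤m; m+n∸n≡m; m+n∸m≡n; m∸n+n≡m; m+[n∸m]≡n; m∸[m∸n]≡n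
        ; [m+n]∸[m+o]≡n∸o; pred[m∸n]≡m∸[1+n])
open import Data.Product using (∃; ∃₂; _×_; _,_; proj₁; proj₂; uncurry; swap)
open import Data.Product.Function.NonDependent.Propositional using (_×-⇔_)
open import Data.Product.Relation.Binary.Pointwise.NonDependent using (_×ₛ_)
open import Data.Unit using (tt)
open import Data.Vec as Vec using (Vec; []; _∷_)
open import Function using (_∘_; id)
open import Function.Bundles using (_⇔_; mk⇔; module Equivalence)
open import Function.Definitions using (Congruent; Injective)
open import Function.Properties.Equivalence using () renaming (refl to ⇔-refl; trans to ⇔-trans)
open import Relation.Binary.Bundles using (Setoid)
open import Relation.Binary.Definitions using (tri<; tri≈; tri>)
open import Relation.Binary.PropositionalEquality as ≡ using (_≡_; _≢_; cong; cong₂)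
open import Relation.Binary.Structures using (IsEquivalence)
open import Relation.Nullary using (¬_; contradiction; yes; no)
open import Relation.Unary using (Pred; U; _⟨×⟩_)

open import Defs

[m+n]∸[1+m+o]≡n∸o∸1 : ∀ m n o → m ℕ.+ n ∸ suc (m ℕ.+ o) ≡ n ∸ o ∸ 1
[m+n]∸[1+m+o]≡n∸o∸1 m n o = begin
  m ℕ.+ n ∸ suc (m ℕ.+ o)   ≡⟨ cong (m ℕ.+ n ∸_) (+-suc m o) ⟨
  m ℕ.+ n ∸ (m ℕ.+ suc o)   ≡⟨ [m+n]∸[m+o]≡n∸o m n (suc o) ⟩
  n ∸ suc o                 ≡⟨ cong (n ∸_) (+-comm 1 o) ⟩
  n ∸ (o ℕ.+ 1)             ≡⟨ ∸-+-assoc n o 1 ⟨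
  n ∸ o ∸ 1                 ∎
  where open ≡.≡-Reasoning

m∸[1+[m∸[1+n]]]≡n : ∀ {m n} → n < m → m ∸ suc (m ∸ suc n) ≡ n
m∸[1+[m∸[1+n]]]≡n {m} {n} n<m = begin
  m ∸ suc (m ∸ suc n)       ≡⟨ pred[m∸n]≡m∸[1+n] m (m ∸ suc n) ⟨
  ℕ.pred (m ∸ (m ∸ suc n))  ≡⟨ cong ℕ.pred (m∸[m∸n]≡n n<m) ⟩
  n                         ∎
  where open ≡.≡-Reasoning

length-cartesianProduct : ∀ {A B : Set} (xs : List A) (ys : List B) →
  length (cartesianProduct xs ys) ≡ length xs ℕ.* length ys
length-cartesianProduct []       ys = ≡.refl
length-cartesianProduct (x ∷ xs) ys = begin
  length (List.map (x ,_) ys ++ cartesianProduct xs ys)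
    ≡⟨ length-++ (List.map (x ,_) ys) ⟩
  length (List.map (x ,_) ys) ℕ.+ length (cartesianProduct xs ys)
    ≡⟨ cong₂ ℕ._+_ (length-map (x ,_) ys) (length-cartesianProduct xs ys) ⟩
  length ys ℕ.+ length xs ℕ.* length ys
    ∎
  where open ≡.≡-Reasoning

module _ (S : Setoid 0ℓ 0ℓ) where
  open Setoid S
  open Membership S using (_∈_)

  record Enumeration (P : Pred Carrier 0ℓ) (n : ℕ) : Set where
    field
      elements        : List Carrier
      length-elements : length elements ≡ n
      sound           : All P elements
      unique          : Unique S elements
      complete        : ∀ x → P x → x ∈ elements

  Enumeration-∅ : ∀ {P} → (∀ x → ¬ P x) → Enumeration P 0
  Enumeration-∅ ¬P = record
    { elements = [] ; length-elements = ≡.refl ; sound = [] ; unique = []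
    ; complete = λ x Px → contradiction Px (¬P x)
    }

module _ {S T : Setoid 0ℓ 0ℓ} where
  private
    module S = Setoid S
    module T = Setoid T

  Enumeration-map : ∀ {P Q n} (f : S.Carrier → T.Carrier) →
    Congruent S._≈_ T._≈_ f → Injective S._≈_ T._≈_ f →
    (∀ {x} → P x → Q (f x)) → (∀ {y} → Q y → ∃ λ x → P x × y T.≈ f x) →
    Enumeration S P n → Enumeration T Q n
  Enumeration-map f f-cong f-inj P⇒Qf Q⇒P E = record
    { elements        = List.map f elements
    ; length-elements = ≡.trans (length-map f elements) length-elements
    ; sound           = All.map⁺ (All.map P⇒Qf sound)
    ; unique          = Unique.map⁺ S T f-inj unique
    ; complete        = λ y Qy → let x , Px , y≈fx = Q⇒P Qy in
        ∈-resp-≈ T (T.sym y≈fx) (∈-map⁺ S T f-cong (complete x Px))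
    }
    where open Enumeration E

  Enumeration-× : ∀ {P Q m n} → Enumeration S P m → Enumeration T Q n →
    Enumeration (S ×ₛ T) (P ⟨×⟩ Q) (m ℕ.* n)
  Enumeration-× E₁ E₂ = record
    { elements        = cartesianProduct E₁.elements E₂.elements
    ; length-elements = ≡.trans (length-cartesianProduct E₁.elements E₂.elements)
                          (cong₂ ℕ._*_ E₁.length-elements E₂.length-elements)
    ; sound           = All.cartesianProduct⁺ (≡.setoid _) (≡.setoid _) E₁.elements E₂.elements
                          (λ x∈ y∈ → All.lookup E₁.sound x∈ , All.lookup E₂.sound y∈)
    ; unique          = Unique.cartesianProduct⁺ S T E₁.unique E₂.unique
    ; complete        = λ { (x , y) (Px , Qy) →
        ∈-cartesianProduct⁺ S T (E₁.complete x Px) (E₂.complete y Qy) }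
    }
    where
      module E₁ = Enumeration E₁
      module E₂ = Enumeration E₂

module _ {c ℓ} (R : CommutativeRing c ℓ) where
  open CommutativeRing R
  open import Algebra.Properties.Group +-group using (//-rightDividesˡ; //-rightDividesʳ)
  open import Relation.Binary.Reasoning.Setoid setoid

  a*x+d≈e⇔x≈a′*[e-d] : ∀ {a a′ x d e} → a * a′ ≈ 1# → (a * x + d ≈ e) ⇔ (x ≈ a′ * (e - d))
  a*x+d≈e⇔x≈a′*[e-d] {a} {a′} {x} {d} {e} aa′≈1 = mk⇔ solve check
    where
      solve : a * x + d ≈ e → x ≈ a′ * (e - d)
      solve ax+d≈e = begin
        x                      ≈⟨ *-identityˡ x ⟨
        1# * x                 ≈⟨ *-congʳ (trans (*-comm a′ a) aa′≈1) ⟨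
        a′ * a * x             ≈⟨ *-assoc a′ a x ⟩
        a′ * (a * x)           ≈⟨ *-congˡ (//-rightDividesʳ d (a * x)) ⟨
        a′ * (a * x + d - d)   ≈⟨ *-congˡ (+-congʳ ax+d≈e) ⟩
        a′ * (e - d)           ∎
      check : x ≈ a′ * (e - d) → a * x + d ≈ e
      check x≈a′[e-d] = begin
        a * x + d              ≈⟨ +-congʳ (*-congˡ x≈a′[e-d]) ⟩
        a * (a′ * (e - d)) + d ≈⟨ +-congʳ (*-assoc a a′ (e - d)) ⟨
        a * a′ * (e - d) + d   ≈⟨ +-congʳ (trans (*-congʳ aa′≈1) (*-identityˡ (e - d))) ⟩
        e - d + d              ≈⟨ //-rightDividesˡ d e ⟩
        e                      ∎

module _ (F : FiniteField) where
  open FiniteField F hiding (zero)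
  open import Data.Vec.Relation.Binary.Equality.Setoid setoid using (_≋_; ≋-refl; ≋-setoid; []; _∷_)

  IsZero : ∀ {m} → (Fin m → Carrier) → Set
  IsZero u = ∀ i → u i ≈ 0#

  wt≡0⇒IsZero : ∀ {m} (u : Fin m → Carrier) → wt F u ≡ 0 → IsZero u
  wt≡0⇒IsZero {suc m} u wt≡0 i with u zero ≟ 0#
  wt≡0⇒IsZero {suc m} u wt≡0 zero    | yes u₀≈0 = u₀≈0
  wt≡0⇒IsZero {suc m} u wt≡0 (suc i) | yes _    = wt≡0⇒IsZero (u ∘ suc) wt≡0 i

  IsZero⇒wt≡0 : ∀ {m} (u : Fin m → Carrier) → IsZero u → wt F u ≡ 0
  IsZero⇒wt≡0 {zero}  u _   = ≡.refl
  IsZero⇒wt≡0 {suc m} u u≈0 with u zero ≟ 0#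
  ... | yes _   = IsZero⇒wt≡0 (u ∘ suc) (u≈0 ∘ suc)
  ... | no u₀≉0 = contradiction (u≈0 zero) u₀≉0

  wt≢0⇒nonzero : ∀ {m} (u : Fin m → Carrier) → wt F u ≢ 0 → ∃ λ i → ¬ u i ≈ 0#
  wt≢0⇒nonzero {zero}  u wt≢0 = contradiction ≡.refl wt≢0
  wt≢0⇒nonzero {suc m} u wt≢0 with u zero ≟ 0#
  ... | yes _   = let i , uᵢ≉0 = wt≢0⇒nonzero (u ∘ suc) wt≢0 in suc i , uᵢ≉0
  ... | no u₀≉0 = zero , u₀≉0

  ∑-cong : ∀ {m} {f g : Fin m → Carrier} → (∀ i → f i ≈ g i) → ∑ F f ≈ ∑ F g
  ∑-cong {zero}  f≈g = refl
  ∑-cong {suc m} f≈g = +-cong (f≈g zero) (∑-cong (f≈g ∘ suc))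

  ∑-*-congˡ : ∀ {m} (u : Fin m → Carrier) {f g : Fin m → Carrier} → (∀ i → f i ≈ g i) →
    ∑ F (λ i → u i * f i) ≈ ∑ F (λ i → u i * g i)
  ∑-*-congˡ u f≈g = ∑-cong (λ i → *-congˡ (f≈g i))

  ∑-zero : ∀ {m} {f : Fin m → Carrier} → IsZero f → ∑ F f ≈ 0#
  ∑-zero {zero}  f≈0 = refl
  ∑-zero {suc m} f≈0 = trans (+-cong (f≈0 zero) (∑-zero (f≈0 ∘ suc))) (+-identityˡ 0#)

  IsZero⇒∑*≈0 : ∀ {m} {u : Fin m → Carrier} (f : Fin m → Carrier) → IsZero u →
    ∑ F (λ i → u i * f i) ≈ 0#
  IsZero⇒∑*≈0 f u≈0 = ∑-zero (λ i → trans (*-congʳ (u≈0 i)) (zeroˡ (f i)))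

  basis : ∀ {m} → Fin m → Fin m → Carrier
  basis zero    zero    = 1#
  basis zero    (suc _) = 0#
  basis (suc _) zero    = 0#
  basis (suc i) (suc l) = basis i l

  ∑-basis : ∀ {m} (i : Fin m) (f : Fin m → Carrier) → ∑ F (λ l → basis i l * f l) ≈ f i
  ∑-basis zero    f = trans (+-cong (*-identityˡ (f zero)) (IsZero⇒∑*≈0 (f ∘ suc) (λ _ → refl)))
                            (+-identityʳ (f zero))
  ∑-basis (suc i) f = trans (+-cong (zeroˡ (f zero)) (∑-basis i (f ∘ suc))) (+-identityˡ (f (suc i)))

  at-cong : ∀ {n} {C C′ : Vec Carrier n} → C ≋ C′ → ∀ x → at F C x ≈ at F C′ x
  at-cong []            x       = refl
  at-cong (c≈c′ ∷ _)    zero    = c≈c′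
  at-cong (_    ∷ C≋C′) (suc x) = at-cong C≋C′ x

  ≋-from-at : ∀ {n} {C C′ : Vec Carrier n} → (∀ x → x < n → at F C x ≈ at F C′ x) → C ≋ C′
  ≋-from-at {C = []}    {[]}      _     = []
  ≋-from-at {C = c ∷ C} {c′ ∷ C′} C≈C′ =
    C≈C′ 0 (s≤s z≤n) ∷ ≋-from-at (λ x x<n → C≈C′ (suc x) (s≤s x<n))

  at-tabulate : ∀ {n} (f : ℕ → Carrier) {x} → x < n → at F (Vec.tabulate {n = n} (f ∘ toℕ)) x ≡ f x
  at-tabulate {suc n} f {zero}  _         = ≡.refl
  at-tabulate {suc n} f {suc x} (s≤s x<n) = at-tabulate (f ∘ suc) x<n

  Enumeration-Carrier : Enumeration setoid U size
  Enumeration-Carrier = record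
    { elements        = List.tabulate enum
    ; length-elements = length-tabulate enum
    ; sound           = All.tabulate⁺ (λ _ → tt)
    ; unique          = AllPairs.tabulate⁺ (λ i≢j eᵢ≈eⱼ → i≢j (enum-inj _ _ eᵢ≈eⱼ))
    ; complete        = λ x _ → let i , eᵢ≈x = enum-surj x in Any.tabulate⁺ i (sym eᵢ≈x)
    }

  Enumeration-∷-free : ∀ {n m} {P : Pred (Vec Carrier n) 0ℓ} {Q : Pred (Vec Carrier (suc n)) 0ℓ} →
    (∀ {c C} → Q (c ∷ C) ⇔ P C) →
    Enumeration (≋-setoid n) P m → Enumeration (≋-setoid (suc n)) Q (size ℕ.* m)
  Enumeration-∷-free Q⇔P E =
    Enumeration-map (uncurry _∷_) (uncurry _∷_) (λ { (c≈c′ ∷ C≋C′) → c≈c′ , C≋C′ })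
      (λ (_ , PC) → Equivalence.from Q⇔P PC)
      (λ { {c ∷ C} Q[c∷C] → (c , C) , (tt , Equivalence.to Q⇔P Q[c∷C]) , ≋-refl })
      (Enumeration-× Enumeration-Carrier E)

  Enumeration-∷-determined : ∀ {n m} {P : Pred (Vec Carrier n) 0ℓ} {Q : Pred (Vec Carrier (suc n)) 0ℓ}
    (s : Vec Carrier n → Carrier) → Congruent _≋_ _≈_ s →
    (∀ {c C} → Q (c ∷ C) ⇔ (c ≈ s C × P C)) →
    Enumeration (≋-setoid n) P m → Enumeration (≋-setoid (suc n)) Q m
  Enumeration-∷-determined s s-cong Q⇔ =
    Enumeration-map (λ C → s C ∷ C) (λ C≋C′ → s-cong C≋C′ ∷ C≋C′) (λ { (_ ∷ C≋C′) → C≋C′ })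
      (λ PC → Equivalence.from Q⇔ (refl , PC))
      (λ { {c ∷ C} Q[c∷C] → let c≈sC , PC = Equivalence.to Q⇔ Q[c∷C] in C , PC , (c≈sC ∷ ≋-refl) })

  Enumeration-Vec : ∀ n → Enumeration (≋-setoid n) U (size ^ n)
  Enumeration-Vec zero    = record
    { elements = [] ∷ [] ; length-elements = ≡.refl ; sound = tt ∷ [] ; unique = [] ∷ []
    ; complete = λ { [] _ → here [] }
    }
  Enumeration-Vec (suc n) = Enumeration-∷-free (mk⇔ _ _) (Enumeration-Vec n)

  SolvesHankel : ∀ {m L n} → (Fin m → Carrier) → (Fin L → Carrier) → Vec Carrier n → Set
  SolvesHankel u v C = ∀ j → ∑ F (λ i → u i * at F C (toℕ j ℕ.+ toℕ i)) ≈ v j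

  SolvesHankel-∷ : ∀ {m L n} {u : Fin (suc m) → Carrier} {v : Fin (suc L) → Carrier} {c} {C : Vec Carrier n} →
    SolvesHankel u v (c ∷ C) ⇔
    (u zero * c + ∑ F (λ i → u (suc i) * at F C (toℕ i)) ≈ v zero × SolvesHankel u (v ∘ suc) C)
  SolvesHankel-∷ = mk⇔ (λ solves → solves zero , solves ∘ suc)
    (λ { (solves₀ , solves₊) zero → solves₀ ; (solves₀ , solves₊) (suc j) → solves₊ j })

  SolvesHankel-head≈0 : ∀ {m L n} {u : Fin (suc m) → Carrier} {v : Fin L → Carrier} {c} {C : Vec Carrier n} →
    u zero ≈ 0# → SolvesHankel u v (c ∷ C) ⇔ SolvesHankel (u ∘ suc) v C
  SolvesHankel-head≈0 {u = u} {c = c} {C} u₀≈0 =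
    mk⇔ (λ solves j → trans (sym (drop-head (toℕ j))) (solves j))
        (λ solves j → trans (drop-head (toℕ j)) (solves j))
    where
      drop-head : ∀ j → ∑ F (λ i → u i * at F (c ∷ C) (j ℕ.+ toℕ i)) ≈
                        ∑ F (λ i → u (suc i) * at F C (j ℕ.+ toℕ i))
      drop-head j = trans (+-cong (trans (*-congʳ u₀≈0) (zeroˡ _))
                                  (∑-*-congˡ (u ∘ suc) λ i →
                                    reflexive (cong (at F (c ∷ C)) (+-suc j (toℕ i)))))
                          (+-identityˡ _)

  Enumeration-SolvesHankel-head≉0 : ∀ {m} (u : Fin (suc m) → Carrier) → ¬ u zero ≈ 0# →
    ∀ {L} (v : Fin L → Carrier) → Enumeration (≋-setoid (L ℕ.+ m)) (SolvesHankel u v) (size ^ m)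
  Enumeration-SolvesHankel-head≉0 {m} u u₀≉0 {zero}  v =
    Enumeration-map id id id (λ _ ()) (λ {C} _ → C , tt , ≋-refl) (Enumeration-Vec m)
  Enumeration-SolvesHankel-head≉0 {m} u u₀≉0 {suc L} v =
    Enumeration-∷-determined s s-cong
      (⇔-trans (SolvesHankel-∷ {u = u} {v = v}) (a*x+d≈e⇔x≈a′*[e-d] commRing u₀u₀⁻¹≈1 ×-⇔ ⇔-refl))
      (Enumeration-SolvesHankel-head≉0 u u₀≉0 (v ∘ suc))
    where
      u₀⁻¹     = proj₁ (inverse (u zero) u₀≉0)
      u₀u₀⁻¹≈1 = proj₂ (inverse (u zero) u₀≉0)
      s : Vec Carrier (L ℕ.+ m) → Carrier
      s C = u₀⁻¹ * (v zero - ∑ F (λ i → u (suc i) * at F C (toℕ i)))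
      s-cong : Congruent _≋_ _≈_ s
      s-cong C≋C′ = *-congˡ (+-congˡ (-‿cong (∑-*-congˡ (u ∘ suc) (λ i → at-cong C≋C′ (toℕ i)))))

  Enumeration-SolvesHankel : ∀ {m} (u : Fin (suc m) → Carrier) → (∃ λ i → ¬ u i ≈ 0#) →
    ∀ {L} (v : Fin L → Carrier) → Enumeration (≋-setoid (L ℕ.+ m)) (SolvesHankel u v) (size ^ m)
  Enumeration-SolvesHankel u (i , uᵢ≉0) v with u zero ≟ 0#
  ... | no u₀≉0 = Enumeration-SolvesHankel-head≉0 u u₀≉0 v
  Enumeration-SolvesHankel u (zero , u₀≉0) v | yes u₀≈0 = contradiction u₀≈0 u₀≉0
  Enumeration-SolvesHankel {suc m} u (suc i , uᵢ≉0) {L} v | yes u₀≈0 rewrite +-suc L m =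
    Enumeration-∷-free (SolvesHankel-head≈0 {u = u} u₀≈0) (Enumeration-SolvesHankel (u ∘ suc) (i , uᵢ≉0) v)

  toeplitz : ∀ {m} → Params F m → Fin m → Fin m → Carrier
  toeplitz (t , a , b) = Toeplitz F t a b

  ∈𝒯⇔v≈uT : ∀ {m} {u v : Fin m → Carrier} {p : Params F m} →
    _∈𝒯_ F (u , v) p ⇔ (∀ j → v j ≈ ∑ F (λ i → u i * toeplitz p i j))
  ∈𝒯⇔v≈uT = mk⇔
    (λ (w , u≈w , v≈wT) j → trans (v≈wT j) (∑-cong (λ i → *-congʳ (sym (u≈w i)))))
    (λ v≈uT → _ , (λ _ → refl) , v≈uT)

  ∈𝒯-resp : ∀ {m} {x : Word F m} {p q : Params F m} →
    (∀ (i j : Fin m) → toeplitz p i j ≈ toeplitz q i j) → _∈𝒯_ F x p → _∈𝒯_ F x q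
  ∈𝒯-resp {x = x} {p} {q} Tp≈Tq x∈p = Equivalence.from (∈𝒯⇔v≈uT {p = q}) λ j →
    trans (Equivalence.to (∈𝒯⇔v≈uT {p = p}) x∈p j) (∑-*-congˡ (proj₁ x) (λ i → Tp≈Tq i j))

  toeplitz≈⇒SameCode : ∀ {m} {p q : Params F m} →
    (∀ (i j : Fin m) → toeplitz p i j ≈ toeplitz q i j) → SameCode F {m} p q
  toeplitz≈⇒SameCode {p = p} {q} Tp≈Tq x =
    ∈𝒯-resp {p = p} {q} Tp≈Tq , ∈𝒯-resp {p = q} {p} (λ i j → sym (Tp≈Tq i j))

  SameCode⇒toeplitz≈ : ∀ {m} {p q : Params F m} → SameCode F {m} p q →
    ∀ (i j : Fin m) → toeplitz p i j ≈ toeplitz q i j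
  SameCode⇒toeplitz≈ {m} {p} {q} p≈q i j = begin
    toeplitz p i j                         ≈⟨ Equivalence.to (∈𝒯⇔v≈uT {p = q}) rowᵢ∈q j ⟩
    ∑ F (λ l → basis i l * toeplitz q l j) ≈⟨ ∑-basis i (λ l → toeplitz q l j) ⟩
    toeplitz q i j                         ∎
    where
      open import Relation.Binary.Reasoning.Setoid setoid
      rowᵢ∈p : _∈𝒯_ F (basis i , λ j → toeplitz p i j) p
      rowᵢ∈p = Equivalence.from (∈𝒯⇔v≈uT {p = p}) (λ j → sym (∑-basis i (λ l → toeplitz p l j)))
      rowᵢ∈q : _∈𝒯_ F (basis i , λ j → toeplitz p i j) q
      rowᵢ∈q = proj₁ (p≈q _) rowᵢ∈p

  codeSetoid : ℕ → Setoid 0ℓ 0ℓ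
  codeSetoid m = record { Carrier = Params F m ; _≈_ = SameCode F {m} ; isEquivalence = SameCode-isEquivalence }
    where
      SameCode-isEquivalence : IsEquivalence (SameCode F {m})
      SameCode-isEquivalence = record
        { refl  = λ _ → id , id
        ; sym   = λ p≈q x → swap (p≈q x)
        ; trans = λ p≈q q≈r x → proj₁ (q≈r x) ∘ proj₁ (p≈q x) , proj₂ (p≈q x) ∘ proj₂ (q≈r x)
        }

  Enumeration⇒NumCodesContaining : ∀ {m x N} →
    Enumeration (codeSetoid m) (_∈𝒯_ F x) N → NumCodesContaining F m x N
  Enumeration⇒NumCodesContaining E = elements , length-elements , sound , unique , complete
    where open Enumeration E

  numCodesContaining-zero-nonzero : ∀ {m} {u v : Fin m → Carrier} → IsZero u → ¬ IsZero v →
    NumCodesContaining F m (u , v) 0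
  numCodesContaining-zero-nonzero u≈0 v≉0 = Enumeration⇒NumCodesContaining (Enumeration-∅ _ λ p uv∈p →
    v≉0 (λ j → trans (Equivalence.to ∈𝒯⇔v≈uT uv∈p j) (IsZero⇒∑*≈0 (λ i → toeplitz p i j) u≈0)))

  module _ (k : ℕ) where

    -- C = (a_k, …, a_1, t, b_1, …, b_k) lists the diagonals of T(t,a,b) from the top right corner
    -- to the bottom left one; diagonal reads the same list off (t , a , b).
    decode : Vec Carrier (suc (k ℕ.+ k)) → Params F (suc k)
    decode C = at F C k
             , Vec.tabulate (λ d → at F C (k ∸ suc (toℕ d)))
             , Vec.tabulate (λ d → at F C (suc k ℕ.+ toℕ d))

    diagonal : Params F (suc k) → ℕ → Carrier
    diagonal (t , a , b) x with <-cmp x k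
    ... | tri< _ _ _ = at F a (k ∸ suc x)
    ... | tri≈ _ _ _ = t
    ... | tri> _ _ _ = at F b (x ∸ suc k)

    encode : Params F (suc k) → Vec Carrier (suc (k ℕ.+ k))
    encode p = Vec.tabulate (diagonal p ∘ toℕ)

    diagonal-< : ∀ t a b {x} → x < k → diagonal (t , a , b) x ≡ at F a (k ∸ suc x)
    diagonal-< t a b {x} x<k with <-cmp x k
    ... | tri< _ _ _   = ≡.refl
    ... | tri≈ x≮k _ _ = contradiction x<k x≮k
    ... | tri> x≮k _ _ = contradiction x<k x≮k

    diagonal-≡ : ∀ t a b → diagonal (t , a , b) k ≡ t
    diagonal-≡ t a b with <-cmp k k
    ... | tri< _ k≢k _ = contradiction ≡.refl k≢k
    ... | tri≈ _ _ _   = ≡.refl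
    ... | tri> _ k≢k _ = contradiction ≡.refl k≢k

    diagonal-> : ∀ t a b {x} → k < x → diagonal (t , a , b) x ≡ at F b (x ∸ suc k)
    diagonal-> t a b {x} k<x with <-cmp x k
    ... | tri< _ _ k≮x = contradiction k<x k≮x
    ... | tri≈ _ _ k≮x = contradiction k<x k≮x
    ... | tri> _ _ _   = ≡.refl

    toeplitz-diagonal : ∀ p (i j : Fin (suc k)) → toeplitz p i j ≡ diagonal p (k ∸ toℕ j ℕ.+ toℕ i)
    toeplitz-diagonal (t , a , b) i j with <-cmp (toℕ i) (toℕ j)
    ... | tri< i<j _ _ = begin
      at F a (toℕ j ∸ toℕ i ∸ 1)         ≡⟨ cong (at F a) index ⟨
      at F a (k ∸ suc (m ℕ.+ toℕ i))     ≡⟨ diagonal-< t a b m+i<k ⟨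
      diagonal (t , a , b) (m ℕ.+ toℕ i) ∎
      where
        open ≡.≡-Reasoning
        m = k ∸ toℕ j
        k≡m+j : k ≡ m ℕ.+ toℕ j
        k≡m+j = ≡.sym (m∸n+n≡m (toℕ≤pred[n] j))
        index : k ∸ suc (m ℕ.+ toℕ i) ≡ toℕ j ∸ toℕ i ∸ 1
        index = ≡.trans (cong (_∸ suc (m ℕ.+ toℕ i)) k≡m+j) ([m+n]∸[1+m+o]≡n∸o∸1 m (toℕ j) (toℕ i))
        m+i<k : m ℕ.+ toℕ i < k
        m+i<k = ≡.subst (m ℕ.+ toℕ i <_) (≡.sym k≡m+j) (+-monoʳ-< m i<j)
    ... | tri≈ _ i≡j _ = begin
      t                                          ≡⟨ diagonal-≡ t a b ⟨
      diagonal (t , a , b) k                     ≡⟨ cong (diagonal (t , a , b)) (m∸n+n≡m (toℕ≤pred[n] j)) ⟨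
      diagonal (t , a , b) (k ∸ toℕ j ℕ.+ toℕ j) ≡⟨ cong (λ n → diagonal (t , a , b) (k ∸ toℕ j ℕ.+ n)) i≡j ⟨
      diagonal (t , a , b) (k ∸ toℕ j ℕ.+ toℕ i) ∎
      where open ≡.≡-Reasoning
    ... | tri> _ _ j<i = begin
      at F b (toℕ i ∸ toℕ j ∸ 1)         ≡⟨ cong (at F b) index ⟨
      at F b (m ℕ.+ toℕ i ∸ suc k)       ≡⟨ diagonal-> t a b k<m+i ⟨
      diagonal (t , a , b) (m ℕ.+ toℕ i) ∎
      where
        open ≡.≡-Reasoning
        m = k ∸ toℕ j
        k≡m+j : k ≡ m ℕ.+ toℕ j
        k≡m+j = ≡.sym (m∸n+n≡m (toℕ≤pred[n] j))
        index : m ℕ.+ toℕ i ∸ suc k ≡ toℕ i ∸ toℕ j ∸ 1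
        index = ≡.trans (cong (λ n → m ℕ.+ toℕ i ∸ suc n) k≡m+j) ([m+n]∸[1+m+o]≡n∸o∸1 m (toℕ i) (toℕ j))
        k<m+i : k < m ℕ.+ toℕ i
        k<m+i = ≡.subst (_< m ℕ.+ toℕ i) (≡.sym k≡m+j) (+-monoʳ-< m j<i)

    diagonal-decode : ∀ C {x} → x < suc (k ℕ.+ k) → diagonal (decode C) x ≡ at F C x
    diagonal-decode C {x} x<2k+1 with <-cmp x k
    ... | tri< x<k _ _ = ≡.trans (at-tabulate (λ d → at F C (k ∸ suc d)) (∸-monoʳ-< z<s x<k))
                                 (cong (at F C) (m∸[1+[m∸[1+n]]]≡n x<k))
    ... | tri≈ _ x≡k _ = cong (at F C) (≡.sym x≡k)
    ... | tri> _ _ k<x = ≡.trans (at-tabulate (λ d → at F C (suc k ℕ.+ d)) x∸[1+k]<k)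
                                 (cong (at F C) (m+[n∸m]≡n k<x))
      where x∸[1+k]<k = ≡.subst (x ∸ suc k <_) (m+n∸m≡n (suc k) k) (∸-monoˡ-< x<2k+1 k<x)

    diagonal-index-< : ∀ (i j : Fin (suc k)) → k ∸ toℕ j ℕ.+ toℕ i < suc (k ℕ.+ k)
    diagonal-index-< i j = s≤s (+-mono-≤ (m∸n≤m k (toℕ j)) (toℕ≤pred[n] i))

    diagonal-index-onto : ∀ {x} → x < suc (k ℕ.+ k) →
      ∃₂ λ (i j : Fin (suc k)) → k ∸ toℕ j ℕ.+ toℕ i ≡ x
    diagonal-index-onto {x} x<2k+1 with x ≤? k
    ... | yes x≤k = zero , fromℕ< k∸x<1+k , (begin
      k ∸ toℕ (fromℕ< k∸x<1+k) ℕ.+ 0 ≡⟨ ℕₚ.+-identityʳ _ ⟩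
      k ∸ toℕ (fromℕ< k∸x<1+k)       ≡⟨ cong (k ∸_) (toℕ-fromℕ< k∸x<1+k) ⟩
      k ∸ (k ∸ x)                    ≡⟨ m∸[m∸n]≡n x≤k ⟩
      x                              ∎)
      where
        open ≡.≡-Reasoning
        k∸x<1+k = s≤s (m∸n≤m k x)
    ... | no x≰k =
      fromℕ< x∸k<1+k , zero , ≡.trans (cong (k ℕ.+_) (toℕ-fromℕ< x∸k<1+k)) (m+[n∸m]≡n (≰⇒≥ x≰k))
      where x∸k<1+k = s≤s (≡.subst (x ∸ k ≤_) (m+n∸n≡m k k) (∸-monoˡ-≤ k (s≤s⁻¹ x<2k+1)))

    toeplitz-decode : ∀ C (i j : Fin (suc k)) → toeplitz (decode C) i j ≡ at F C (k ∸ toℕ j ℕ.+ toℕ i)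
    toeplitz-decode C i j = ≡.trans (toeplitz-diagonal (decode C) i j) (diagonal-decode C (diagonal-index-< i j))

    toeplitz-decode-encode : ∀ p (i j : Fin (suc k)) → toeplitz (decode (encode p)) i j ≡ toeplitz p i j
    toeplitz-decode-encode p i j = begin
      toeplitz (decode (encode p)) i j      ≡⟨ toeplitz-decode (encode p) i j ⟩
      at F (encode p) (k ∸ toℕ j ℕ.+ toℕ i) ≡⟨ at-tabulate (diagonal p) (diagonal-index-< i j) ⟩
      diagonal p (k ∸ toℕ j ℕ.+ toℕ i)      ≡⟨ toeplitz-diagonal p i j ⟨
      toeplitz p i j                        ∎
      where open ≡.≡-Reasoning

    decode-cong : Congruent _≋_ (SameCode F {suc k}) decode
    decode-cong {C} {C′} C≋C′ = toeplitz≈⇒SameCode {p = decode C} {decode C′} λ i j → begin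
      toeplitz (decode C) i j       ≡⟨ toeplitz-decode C i j ⟩
      at F C (k ∸ toℕ j ℕ.+ toℕ i)  ≈⟨ at-cong C≋C′ _ ⟩
      at F C′ (k ∸ toℕ j ℕ.+ toℕ i) ≡⟨ toeplitz-decode C′ i j ⟨
      toeplitz (decode C′) i j      ∎
      where open import Relation.Binary.Reasoning.Setoid setoid

    decode-injective : Injective _≋_ (SameCode F {suc k}) decode
    decode-injective {C} {C′} same = ≋-from-at λ x x<2k+1 →
      let i , j , index≡x = diagonal-index-onto x<2k+1 in begin
      at F C x                      ≡⟨ cong (at F C) index≡x ⟨
      at F C (k ∸ toℕ j ℕ.+ toℕ i)  ≡⟨ toeplitz-decode C i j ⟨
      toeplitz (decode C) i j       ≈⟨ SameCode⇒toeplitz≈ {p = decode C} {decode C′} same i j ⟩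
      toeplitz (decode C′) i j      ≡⟨ toeplitz-decode C′ i j ⟩
      at F C′ (k ∸ toℕ j ℕ.+ toℕ i) ≡⟨ cong (at F C′) index≡x ⟩
      at F C′ x                     ∎
      where open import Relation.Binary.Reasoning.Setoid setoid

    numCodesContaining-decode : ∀ {x : Word F (suc k)} {Q : Pred (Vec Carrier (suc (k ℕ.+ k))) 0ℓ} {N} →
      (∀ {C} → Q C ⇔ _∈𝒯_ F x (decode C)) →
      Enumeration (≋-setoid (suc (k ℕ.+ k))) Q N → NumCodesContaining F (suc k) x N
    numCodesContaining-decode {x} {Q} Q⇔x∈ E =
      Enumeration⇒NumCodesContaining
        (Enumeration-map decode decode-cong decode-injective (Equivalence.to Q⇔x∈) preimage E)
      where
        preimage : ∀ {p} → _∈𝒯_ F x p → ∃ λ C → Q C × SameCode F {suc k} p (decode C)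
        preimage {p} x∈p = encode p , Equivalence.from Q⇔x∈ (proj₁ (p≈ x) x∈p) , p≈
          where
            p≈ : SameCode F {suc k} p (decode (encode p))
            p≈ = toeplitz≈⇒SameCode {p = p} {decode (encode p)} λ i j →
              sym (reflexive (toeplitz-decode-encode p i j))

    numCodesContaining-zero-zero : ∀ {u v : Fin (suc k) → Carrier} → IsZero u → IsZero v →
      NumCodesContaining F (suc k) (u , v) (size ^ suc (k ℕ.+ k))
    numCodesContaining-zero-zero {u} {v} u≈0 v≈0 =
      numCodesContaining-decode (mk⇔ (λ _ → zero∈) _) (Enumeration-Vec _)
      where
        zero∈ : ∀ {p} → _∈𝒯_ F (u , v) p
        zero∈ {p} = Equivalence.from (∈𝒯⇔v≈uT {p = p}) λ j →
          trans (v≈0 j) (sym (IsZero⇒∑*≈0 (λ i → toeplitz p i j) u≈0))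

    -- Column j of T is equation k − j of the Hankel system.
    SolvesHankel⇔∈𝒯-decode : ∀ {u v : Fin (suc k) → Carrier} {C} →
      SolvesHankel u (v ∘ opposite) C ⇔ _∈𝒯_ F (u , v) (decode C)
    SolvesHankel⇔∈𝒯-decode {u} {v} {C} = mk⇔
      (λ solves → Equivalence.from (∈𝒯⇔v≈uT {p = decode C}) λ j →
        ≡.subst (λ j → v j ≈ ∑ F (λ i → u i * toeplitz (decode C) i j)) (opposite-involutive j)
          (trans (sym (solves (opposite j))) (∑-*-congˡ u λ i → reflexive (≡.sym (entry i (opposite j))))))
      (λ uv∈ j → trans (∑-*-congˡ u λ i → reflexive (≡.sym (entry i j)))
                       (sym (Equivalence.to (∈𝒯⇔v≈uT {p = decode C}) uv∈ (opposite j))))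
      where
        entry : ∀ i j → toeplitz (decode C) i (opposite j) ≡ at F C (toℕ j ℕ.+ toℕ i)
        entry i j = ≡.trans (toeplitz-decode C i (opposite j))
          (cong (λ n → at F C (n ℕ.+ toℕ i))
                (≡.trans (cong (k ∸_) (opposite-prop j)) (m∸[m∸n]≡n (toℕ≤pred[n] j))))

    numCodesContaining-nonzero : ∀ {u v : Fin (suc k) → Carrier} → (∃ λ i → ¬ u i ≈ 0#) →
      NumCodesContaining F (suc k) (u , v) (size ^ k)
    numCodesContaining-nonzero {u} {v} u≉0 =
      numCodesContaining-decode (λ {C} → SolvesHankel⇔∈𝒯-decode {u} {v} {C})
        (Enumeration-SolvesHankel u u≉0 (v ∘ opposite))

lemma3p2 : (F : FiniteField) (n : ℕ) → 0 < n → 2 ∣ n →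
    (u v : Fin (n / 2) → FiniteField.Carrier F) →
      ((wt F u ≡ 0 → wt F v ≡ 0 →
          NumCodesContaining F (n / 2) (u , v) (FiniteField.size F ^ (n ∸ 1)))
      × (wt F u ≡ 0 → ¬ (wt F v ≡ 0) →
          NumCodesContaining F (n / 2) (u , v) 0)
      × (¬ (wt F u ≡ 0) →
          NumCodesContaining F (n / 2) (u , v) (FiniteField.size F ^ (n / 2 ∸ 1))))
lemma3p2 F n () (divides zero ≡.refl)
lemma3p2 F _ _ (divides (suc k) ≡.refl) rewrite m*n/n≡m (suc k) 2 ⦃ _ ⦄ | ℕₚ.*-comm k 2 | ℕₚ.+-identityʳ k =
  λ u v →
    (λ wt-u≡0 wt-v≡0 → numCodesContaining-zero-zero F k (wt≡0⇒IsZero F u wt-u≡0) (wt≡0⇒IsZero F v wt-v≡0))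
  , (λ wt-u≡0 wt-v≢0 → numCodesContaining-zero-nonzero F (wt≡0⇒IsZero F u wt-u≡0) (wt-v≢0 ∘ IsZero⇒wt≡0 F v))
  , (λ wt-u≢0 → numCodesContaining-nonzero F k (wt≢0⇒nonzero F u wt-u≢0))
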